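{- Let $X$ be a simplicial complex, let $w:X\to\mathbb{R}_{>0}$, and let $0\le\ell<k\le\dim(X)$. Then for all $\sigma,\tau\in X(k)$, \[ \sum_{\substack{\eta\in X(\ell):\\ \sigma,\tau\in X_\eta(k)}} s_\eta(\sigma)s_\eta(\tau)\cdot(k+1)\cdot\big(\mathcal{L}^{ - }_{\eta}\big)_{\sigma,\tau}=(k-\ell)\cdot\mathcal{L}^-_k(X;w)_{\sigma,\tau}. \]
   Context: A simplicial complex $X$ on a finite vertex set $V$ is a family of subsets of $V$ closed under taking subsets (it contains $\emptyset$); $X(k)$ is the set of its $k$-dimensional faces (faces of size $k+1$), so $X(-1)=\{\emptyset\}$. Fix a linear order $<$ on $V$. For $\sigma\in X(k-1)$, $\tau\in X(k)$ with $\sigma\subset\tau$, let $(\tau:\sigma)=(-1)^{|\{v\in\tau:\,v<u\}|}$, where $u$ is the unique vertex of $\tau\setminus\sigma$. The boundary matrix $\partial_k(X)\in\mathbb{R}^{X(k-1)\times X(k)}$ has $(\sigma,\tau)$-entry $(\tau:\sigma)$ if $\sigma\subset\tau$ and $0$ otherwise. For $w:X\to\mathbb{R}_{>0}$, $W_k(X)$ is the diagonal matrix indexed by $X(k)$ with entries $w(\sigma)$. For $0\le k\le\dim X$, $\mathcal{L}^-_k(X;w)=W_k(X)^{1/2}\partial_k(X)^TW_{k-1}(X)^{ -1}\partial_k(X)W_k(X)^{1/2}$. The link of $\eta\in X$ is $\mathrm{lk}(X,\eta)=\{\tau\in X:\,\tau\cap\eta=\emptyset,\ \tau\cup\eta\in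 X\}$ (with the induced vertex order), with weights $w_\eta(\sigma)=w(\sigma\cup\eta)$. For $\eta\in X(\ell)$ let $X_\eta(k)=\{\sigma\in X(k):\,\eta\subset\sigma\}$, and for $\sigma\in X_\eta(k)$ let $s_\eta(\sigma)=\binom{k+1}{\ell+1}^{ -1/2}(-1)^{|\{(i,j):\,i\in\sigma\setminus\eta,\ j\in\eta,\ i>j\}|}$. When $X_\eta(k)\neq\emptyset$, the map $\sigma\mapsto\sigma\setminus\eta$ is a bijection $X_\eta(k)\to\mathrm{lk}(X,\eta)(k-\ell-1)$, and $\mathcal{L}^-_\eta\in\mathbb{R}^{X_\eta(k)\times X_\eta(k)}$ is defined by $(\mathcal{L}^-_\eta)_{\sigma,\tau}=\mathcal{L}^-_{k-\ell-1}(\mathrm{lk}(X,\eta);w_\eta)_{\sigma\setminus\eta,\tau\setminus\eta}$. -}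

module Defs where

open import Level using (Level; _⊔_; suc)
open import Algebra.Bundles using (CommutativeRing)
open import Data.Bool using (Bool; true; false; _∧_; if_then_else_)
open import Data.Nat as ℕ using (ℕ; zero; _<ᵇ_; _≡ᵇ_)
open import Data.Nat.Combinatorics using (_C_)
open import Data.Fin using (Fin; toℕ)
import Data.Fin.Subset as S
open import Data.Fin.Subset using (Subset; ⊥; _∩_; _∪_; _─_; _⊆_; ∣_∣; _∈_)
open import Data.Fin.Subset.Properties using (_⊆?_; _∈?_)
open import Data.Vec using (Vec; []; _∷_; tabulate)
open import Data.Vec.Properties using (≡-dec)
open import Data.List using (List; []; _∷_; [_]; map; _++_; foldr; filterᵇ; allFin)
open import Data.Product using (Σ; _×_)
open import Relation.Nullary using (¬_; does)
open import Relation.Binary.PropositionalEquality using (_≡_)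
import Data.Bool.Properties as BoolP

-- Scalars: a commutative ring with a positive cone in which every
-- positive element has an inverse and a square root (ℝ with the
-- positive reals, inverse and the positive square root is an instance).

record SqrtField (c ℓ : Level) : Set (Level.suc (c ⊔ ℓ)) where
  field
    scalars : CommutativeRing c ℓ
  open CommutativeRing scalars public
  field
    Pos       : Carrier → Set ℓ
    Pos-resp  : ∀ {x y} → x ≈ y → Pos x → Pos y
    Pos-1     : Pos 1#
    Pos-+     : ∀ {x y} → Pos x → Pos y → Pos (x + y)
    Pos-*     : ∀ {x y} → Pos x → Pos y → Pos (x * y)
    nontrivial : ¬ (1# ≈ 0#)
    inv       : Carrier → Carrier
    inv-cong  : ∀ {x y} → x ≈ y → inv x ≈ inv y
    inv-r     : ∀ {x} → Pos x → x * inv x ≈ 1#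
    sqrt      : Carrier → Carrier
    sqrt-cong : ∀ {x y} → x ≈ y → sqrt x ≈ sqrt y
    sqrt-pos  : ∀ {x} → Pos x → Pos (sqrt x)
    sqrt-sq   : ∀ {x} → Pos x → sqrt x * sqrt x ≈ x

allSubsets : ∀ n → List (Subset n)
allSubsets zero = [ [] ]
allSubsets (ℕ.suc n) = map (true ∷_) (allSubsets n) ++ map (false ∷_) (allSubsets n)

_≟ˢ_ : ∀ {n} → Subset n → Subset n → Bool
σ ≟ˢ τ = does (≡-dec BoolP._≟_ σ τ)

_⊆ᵇ_ : ∀ {n} → Subset n → Subset n → Bool
σ ⊆ᵇ τ = does (σ ⊆? τ)

_∈ᵇ_ : ∀ {n} → Fin n → Subset n → Bool
u ∈ᵇ τ = does (u ∈? τ)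

below : ∀ {n} → Fin n → Subset n
below u = tabulate (λ v → toℕ v <ᵇ toℕ u)

record SimplicialComplex (n : ℕ) : Set where
  field
    face        : Subset n → Bool
    empty-face  : face ⊥ ≡ true
    down-closed : ∀ {σ τ} → σ ⊆ τ → face τ ≡ true → face σ ≡ true
open SimplicialComplex public

-- faces of a face family of cardinality m (i.e. dimension m - 1)
facesOfSize : ∀ {n} → (Subset n → Bool) → ℕ → List (Subset n)
facesOfSize {n} X m = filterᵇ (λ σ → X σ ∧ (∣ σ ∣ ≡ᵇ m)) (allSubsets n)

-- link of η (as a face family on the same ordered vertex set)
link : ∀ {n} → (Subset n → Bool) → Subset n → (Subset n → Bool)
link X η τ = ((τ ∩ η) ≟ˢ ⊥) ∧ X (τ ∪ η)

inversions : ∀ {n} → Subset n → Subset n → ℕ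
inversions {n} σ η =
  foldr (λ i acc → (if i ∈ᵇ (σ ─ η) then ∣ η ∩ below i ∣ else 0) ℕ.+ acc) 0 (allFin n)

module _ {c ℓ} (F : SqrtField c ℓ) where
  open SqrtField F

  fromℕ : ℕ → Carrier
  fromℕ zero = 0#
  fromℕ (ℕ.suc m) = 1# + fromℕ m

  sign : ℕ → Carrier
  sign zero = 1#
  sign (ℕ.suc m) = - sign m

  sumL : ∀ {A : Set} → (A → Carrier) → List A → Carrier
  sumL f xs = foldr (λ x acc → f x + acc) 0# xs

  -- boundary entry (τ : σ): if τ ∖ σ = {u} with σ ⊂ τ, the sign
  -- (-1)^|{v ∈ τ : v < u}|, otherwise 0 (at most one u qualifies)
  bd : ∀ {n} → Subset n → Subset n → Carrier
  bd {n} σ τ = sumL (λ u → if (u ∈ᵇ τ) ∧ (σ ≟ˢ (τ S.- u))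
                             then sign ∣ τ ∩ below u ∣ else 0#) (allFin n)

  -- (σ,τ)-entry of  L⁻_k(X;w) = W_k^{1/2} ∂_kᵀ W_{k-1}^{-1} ∂_k W_k^{1/2}
  -- for σ, τ ∈ X(k); the sum ranges over ρ ∈ X(k-1), i.e. faces of size k.
  Ldown : ∀ {n} → (Subset n → Bool) → (Subset n → Carrier) → ℕ →
          Subset n → Subset n → Carrier
  Ldown X w k σ τ =
    sqrt (w σ) * sumL (λ ρ → bd ρ σ * inv (w ρ) * bd ρ τ) (facesOfSize X k) * sqrt (w τ)

  Leta : ∀ {n} → (Subset n → Bool) → (Subset n → Carrier) → (ℓ' k : ℕ) →
         Subset n → Subset n → Subset n → Carrier
  Leta X w ℓ' k η σ τ =
    Ldown (link X η) (λ ρ → w (ρ ∪ η)) (k ℕ.∸ ℓ' ℕ.∸ 1) (σ ─ η) (τ ─ η)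

  sη : ∀ {n} → (ℓ' k : ℕ) → Subset n → Subset n → Carrier
  sη ℓ' k η σ = inv (sqrt (fromℕ ((ℕ.suc k) C (ℕ.suc ℓ')))) * sign (inversions σ η)

{-# OPTIONS --safe #-}
module Submission where

-- Both sides are sums over the (k-1)-faces ρ of X contained in σ ∩ τ. Under the bijection
-- ρ′ ↦ ρ′ ∪ η between the link of η and the faces containing η, a boundary coefficient of
-- the link differs from the corresponding one of X exactly by the signs (-1)^inversions
-- against η (the inversion counts form a cocycle), and s_η(σ) s_η(τ) cancels them. So the
-- left side is (k+1)/C(k+1,ℓ+1) times the right-hand sum, in which each ρ is counted once
-- for every ℓ-face η ⊆ ρ, i.e. C(k,ℓ+1) times; and (k+1) C(k,ℓ+1) = (k-ℓ) C(k+1,ℓ+1).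

open import Defs
open import Data.Bool using (true; _∧_)
open import Data.Nat using (ℕ; suc; _<_; _≤_; _∸_)
open import Data.Fin.Subset using (Subset; ∣_∣)
open import Data.List using (filterᵇ)
open import Data.Product using (Σ; _×_)
open import Relation.Binary.PropositionalEquality using (_≡_)
open import Algebra.Bundles using (Semiring)
import Relation.Binary.Reasoning.Setoid as SetoidReasoning

module Arithmetic where

  open import Data.Nat using (zero; suc; _+_; _*_; _∸_; _≤_; _<_; _≡ᵇ_; z≤n; s≤s)
  open import Data.Nat.Properties
  open import Data.Nat.Combinatorics using (_C_; nCk+nC[k+1]≡[n+1]C[k+1])
  open import Data.Nat.Combinatorics.Specification using (k>n⇒nCk≡0)
  open import Relation.Binary.PropositionalEquality
  open import Data.Bool using (true; T)
  open import Data.Unit using (tt)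
  open ≡-Reasoning

  [k+1]*[n+1]C[k+1]≡[n+1]*nCk : ∀ n k → suc k * (suc n C suc k) ≡ suc n * (n C k)
  [k+1]*[n+1]C[k+1]≡[n+1]*nCk zero zero = refl
  [k+1]*[n+1]C[k+1]≡[n+1]*nCk zero (suc k) =
    trans (cong (suc (suc k) *_) (k>n⇒nCk≡0 {1} {suc (suc k)} (s≤s (s≤s z≤n)))) (*-zeroʳ (suc (suc k)))
  [k+1]*[n+1]C[k+1]≡[n+1]*nCk (suc n) k = begin
    suc k * (suc (suc n) C suc k)                  ≡⟨ cong (suc k *_) (nCk+nC[k+1]≡[n+1]C[k+1] (suc n) k) ⟨
    suc k * (suc n C k + suc n C suc k)            ≡⟨ *-distribˡ-+ (suc k) (suc n C k) _ ⟩
    suc k * (suc n C k) + suc k * (suc n C suc k)  ≡⟨ cong (suc k * (suc n C k) +_) ([k+1]*[n+1]C[k+1]≡[n+1]*nCk n k) ⟩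
    suc k * (suc n C k) + suc n * (n C k)          ≡⟨ +-assoc (suc n C k) (k * (suc n C k)) _ ⟩
    suc n C k + (k * (suc n C k) + suc n * (n C k)) ≡⟨ cong (suc n C k +_) (k*[n+1]Ck+[n+1]*nCk k) ⟩
    suc (suc n) * (suc n C k)                      ∎
    where
    k*[n+1]Ck+[n+1]*nCk : ∀ k → k * (suc n C k) + suc n * (n C k) ≡ suc n * (suc n C k)
    k*[n+1]Ck+[n+1]*nCk zero = refl
    k*[n+1]Ck+[n+1]*nCk (suc k) = begin
      suc k * (suc n C suc k) + suc n * (n C suc k) ≡⟨ cong (_+ suc n * (n C suc k)) ([k+1]*[n+1]C[k+1]≡[n+1]*nCk n k) ⟩
      suc n * (n C k) + suc n * (n C suc k)         ≡⟨ *-distribˡ-+ (suc n) (n C k) _ ⟨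
      suc n * (n C k + n C suc k)                   ≡⟨ cong (suc n *_) (nCk+nC[k+1]≡[n+1]C[k+1] n k) ⟩
      suc n * (suc n C suc k)                       ∎

  [n+1]*nC[k+1]≡[n∸k]*[n+1]C[k+1] : ∀ {n k} → k < n → suc n * (n C suc k) ≡ (n ∸ k) * (suc n C suc k)
  [n+1]*nC[k+1]≡[n∸k]*[n+1]C[k+1] {n} {k} k<n = +-cancelʳ-≡ (suc k * B) _ _ (begin
    suc n * (n C suc k) + suc k * B          ≡⟨ cong (suc n * (n C suc k) +_) ([k+1]*[n+1]C[k+1]≡[n+1]*nCk n k) ⟩
    suc n * (n C suc k) + suc n * (n C k)    ≡⟨ *-distribˡ-+ (suc n) (n C suc k) _ ⟨
    suc n * (n C suc k + n C k)              ≡⟨ cong (suc n *_) (+-comm (n C suc k) (n C k)) ⟩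
    suc n * (n C k + n C suc k)              ≡⟨ cong (suc n *_) (nCk+nC[k+1]≡[n+1]C[k+1] n k) ⟩
    suc n * B                                ≡⟨ cong (_* B) n∸k+[k+1]≡n+1 ⟨
    (n ∸ k + suc k) * B                      ≡⟨ *-distribʳ-+ B (n ∸ k) (suc k) ⟩
    (n ∸ k) * B + suc k * B                  ∎)
    where
    B = suc n C suc k
    n∸k+[k+1]≡n+1 : n ∸ k + suc k ≡ suc n
    n∸k+[k+1]≡n+1 = trans (+-suc (n ∸ k) k) (cong suc (m∸n+n≡m (<⇒≤ k<n)))

  0<nCk : ∀ {n k} → k ≤ n → 0 < n C k
  0<nCk {k = zero} _ = s≤s z≤n
  0<nCk {suc n} {suc k} (s≤s k≤n) =
    subst (0 <_) (nCk+nC[k+1]≡[n+1]C[k+1] n k) (<-≤-trans (0<nCk k≤n) (m≤m+n _ _))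

  +-cancelˡ-≡ᵇ : ∀ j m n → (j + m ≡ᵇ j + n) ≡ (m ≡ᵇ n)
  +-cancelˡ-≡ᵇ zero    m n = refl
  +-cancelˡ-≡ᵇ (suc j) m n = +-cancelˡ-≡ᵇ j m n

  ≡ᵇ-true⇒≡ : ∀ m n → (m ≡ᵇ n) ≡ true → m ≡ n
  ≡ᵇ-true⇒≡ m n h = ≡ᵇ⇒≡ m n (subst T (sym h) tt)

  [ℓ+1]+[k∸ℓ∸1]≡k : ∀ {ℓ k} → ℓ < k → suc ℓ + (k ∸ ℓ ∸ 1) ≡ k
  [ℓ+1]+[k∸ℓ∸1]≡k {ℓ} {k} ℓ<k =
    trans (cong (suc ℓ +_) (trans (∸-+-assoc k ℓ 1) (cong (k ∸_) (+-comm ℓ 1)))) (m+[n∸m]≡n ℓ<k)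

module Subsets where

  open import Data.Bool using (Bool; true; false; _∧_; if_then_else_)
  open import Data.Bool.Properties as Bool using (∧-zeroʳ)
  open import Data.Vec.Properties using (≡-dec)
  open import Data.Nat using (ℕ; zero; suc; _+_; _≡ᵇ_)
  open import Data.Nat.Properties using (+-assoc; +-suc; +-commutativeSemigroup)
  open import Algebra.Properties.CommutativeSemigroup +-commutativeSemigroup using (interchange; xy∙z≈xz∙y)
  open import Data.Fin using (Fin; zero; suc)
  open import Data.Fin.Subset using (Subset; _─_; _∩_; _∪_; ∣_∣; _⊆_; ⊥)
  open import Data.Fin.Subset.Properties using (_⊆?_; ⊆-trans; ∩-zeroʳ; ∣⊥∣≡0)
  open import Data.Vec using ([]; _∷_)
  open import Data.List using (foldr; allFin)
  open import Data.List.Properties using (foldr-map; map-tabulate)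
  open import Function using (id; _∘_)
  open import Relation.Nullary using (Dec; yes; does)
  open import Relation.Nullary.Decidable using (dec-true)
  open import Relation.Binary.PropositionalEquality
  open ≡-Reasoning

  isFaceOfSize : ∀ {n} → (Subset n → Bool) → ℕ → Subset n → Bool
  isFaceOfSize X m ρ = X ρ ∧ (∣ ρ ∣ ≡ᵇ m)

  _⋖ᵇ_ : ∀ {n} → Subset n → Subset n → Bool
  ρ ⋖ᵇ σ = ρ ⊆ᵇ σ ∧ (∣ σ ─ ρ ∣ ≡ᵇ 1)

  does⇒ : ∀ {p} {P : Set p} (P? : Dec P) → does P? ≡ true → P
  does⇒ (yes p) _ = p

  ⊆ᵇ⇒⊆ : ∀ {n} {p q : Subset n} → p ⊆ᵇ q ≡ true → p ⊆ q
  ⊆ᵇ⇒⊆ {p = p} {q} = does⇒ (p ⊆? q)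

  ≟ˢ⇒≡ : ∀ {n} {p q : Subset n} → p ≟ˢ q ≡ true → p ≡ q
  ≟ˢ⇒≡ {p = p} {q} = does⇒ (≡-dec Bool._≟_ p q)

  ⊆ᵇ-trans : ∀ {n} (p q r : Subset n) → p ⊆ᵇ q ≡ true → q ⊆ᵇ r ≡ true → p ⊆ᵇ r ≡ true
  ⊆ᵇ-trans p q r p⊆q q⊆r = dec-true (p ⊆? r) (⊆-trans (⊆ᵇ⇒⊆ p⊆q) (⊆ᵇ⇒⊆ q⊆r))

  q⊆p⇒p─q∪q≡p : ∀ {n} (p q : Subset n) → q ⊆ᵇ p ≡ true → (p ─ q) ∪ q ≡ p
  q⊆p⇒p─q∪q≡p []            []            _ = refl
  q⊆p⇒p─q∪q≡p (true  ∷ p)   (true  ∷ q)   h = cong (true ∷_) (q⊆p⇒p─q∪q≡p p q h)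
  q⊆p⇒p─q∪q≡p (true  ∷ p)   (false ∷ q)   h = cong (true ∷_) (q⊆p⇒p─q∪q≡p p q h)
  q⊆p⇒p─q∪q≡p (false ∷ p)   (false ∷ q)   h = cong (false ∷_) (q⊆p⇒p─q∪q≡p p q h)

  q⊆p⇒∣p∣≡∣q∣+∣p─q∣ : ∀ {n} (p q : Subset n) → q ⊆ᵇ p ≡ true → ∣ p ∣ ≡ ∣ q ∣ + ∣ p ─ q ∣
  q⊆p⇒∣p∣≡∣q∣+∣p─q∣ []          []          _ = refl
  q⊆p⇒∣p∣≡∣q∣+∣p─q∣ (true  ∷ p) (true  ∷ q) h = cong suc (q⊆p⇒∣p∣≡∣q∣+∣p─q∣ p q h)
  q⊆p⇒∣p∣≡∣q∣+∣p─q∣ (true  ∷ p) (false ∷ q) h =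
    trans (cong suc (q⊆p⇒∣p∣≡∣q∣+∣p─q∣ p q h)) (sym (+-suc ∣ q ∣ ∣ p ─ q ∣))
  q⊆p⇒∣p∣≡∣q∣+∣p─q∣ (false ∷ p) (false ∷ q) h = q⊆p⇒∣p∣≡∣q∣+∣p─q∣ p q h

  r⊆q⇒[p─r]─[q─r]≡p─q : ∀ {n} (p q r : Subset n) → r ⊆ᵇ q ≡ true → (p ─ r) ─ (q ─ r) ≡ p ─ q
  r⊆q⇒[p─r]─[q─r]≡p─q []      []          []          _ = refl
  r⊆q⇒[p─r]─[q─r]≡p─q (x ∷ p) (true  ∷ q) (true  ∷ r) h = cong (false ∷_) (r⊆q⇒[p─r]─[q─r]≡p─q p q r h)
  r⊆q⇒[p─r]─[q─r]≡p─q (x ∷ p) (true  ∷ q) (false ∷ r) h = cong (false ∷_) (r⊆q⇒[p─r]─[q─r]≡p─q p q r h)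
  r⊆q⇒[p─r]─[q─r]≡p─q (x ∷ p) (false ∷ q) (false ∷ r) h = cong (x ∷_) (r⊆q⇒[p─r]─[q─r]≡p─q p q r h)

  r⊆p⇒[q─r]⊆[p─r]≡q⊆p : ∀ {n} (p q r : Subset n) → r ⊆ᵇ p ≡ true → (q ─ r) ⊆ᵇ (p ─ r) ≡ q ⊆ᵇ p
  r⊆p⇒[q─r]⊆[p─r]≡q⊆p []          []          []          _ = refl
  r⊆p⇒[q─r]⊆[p─r]≡q⊆p (true  ∷ p) (true  ∷ q) (true  ∷ r) h = r⊆p⇒[q─r]⊆[p─r]≡q⊆p p q r h
  r⊆p⇒[q─r]⊆[p─r]≡q⊆p (true  ∷ p) (false ∷ q) (true  ∷ r) h = r⊆p⇒[q─r]⊆[p─r]≡q⊆p p q r h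
  r⊆p⇒[q─r]⊆[p─r]≡q⊆p (true  ∷ p) (true  ∷ q) (false ∷ r) h = r⊆p⇒[q─r]⊆[p─r]≡q⊆p p q r h
  r⊆p⇒[q─r]⊆[p─r]≡q⊆p (true  ∷ p) (false ∷ q) (false ∷ r) h = r⊆p⇒[q─r]⊆[p─r]≡q⊆p p q r h
  r⊆p⇒[q─r]⊆[p─r]≡q⊆p (false ∷ p) (true  ∷ q) (false ∷ r) h = refl
  r⊆p⇒[q─r]⊆[p─r]≡q⊆p (false ∷ p) (false ∷ q) (false ∷ r) h = r⊆p⇒[q─r]⊆[p─r]≡q⊆p p q r h

  r⊆q⊆p⇒∣p─r∣≡∣p─q∣+∣q─r∣ : ∀ {n} (p q r : Subset n) → r ⊆ᵇ q ≡ true → q ⊆ᵇ p ≡ true →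
                            ∣ p ─ r ∣ ≡ ∣ p ─ q ∣ + ∣ q ─ r ∣
  r⊆q⊆p⇒∣p─r∣≡∣p─q∣+∣q─r∣ []          []          []          _ _ = refl
  r⊆q⊆p⇒∣p─r∣≡∣p─q∣+∣q─r∣ (true  ∷ p) (true  ∷ q) (true  ∷ r) h h′ = r⊆q⊆p⇒∣p─r∣≡∣p─q∣+∣q─r∣ p q r h h′
  r⊆q⊆p⇒∣p─r∣≡∣p─q∣+∣q─r∣ (true  ∷ p) (true  ∷ q) (false ∷ r) h h′ =
    trans (cong suc (r⊆q⊆p⇒∣p─r∣≡∣p─q∣+∣q─r∣ p q r h h′)) (sym (+-suc ∣ p ─ q ∣ ∣ q ─ r ∣))
  r⊆q⊆p⇒∣p─r∣≡∣p─q∣+∣q─r∣ (true  ∷ p) (false ∷ q) (false ∷ r) h h′ = cong suc (r⊆q⊆p⇒∣p─r∣≡∣p─q∣+∣q─r∣ p q r h h′)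
  r⊆q⊆p⇒∣p─r∣≡∣p─q∣+∣q─r∣ (false ∷ p) (false ∷ q) (false ∷ r) h h′ = r⊆q⊆p⇒∣p─r∣≡∣p─q∣+∣q─r∣ p q r h h′

  ∣p─p∣≡0 : ∀ {n} (p : Subset n) → ∣ p ─ p ∣ ≡ 0
  ∣p─p∣≡0 []          = refl
  ∣p─p∣≡0 (true  ∷ p) = ∣p─p∣≡0 p
  ∣p─p∣≡0 (false ∷ p) = ∣p─p∣≡0 p

  q⊆p∧∣p─q∣≡0≡q≟p : ∀ {n} (p q : Subset n) → (q ⊆ᵇ p ∧ (∣ p ─ q ∣ ≡ᵇ 0)) ≡ (q ≟ˢ p)
  q⊆p∧∣p─q∣≡0≡q≟p []          []          = refl
  q⊆p∧∣p─q∣≡0≡q≟p (true  ∷ p) (true  ∷ q) = q⊆p∧∣p─q∣≡0≡q≟p p q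
  q⊆p∧∣p─q∣≡0≡q≟p (true  ∷ p) (false ∷ q) = ∧-zeroʳ (q ⊆ᵇ p)
  q⊆p∧∣p─q∣≡0≡q≟p (false ∷ p) (true  ∷ q) = refl
  q⊆p∧∣p─q∣≡0≡q≟p (false ∷ p) (false ∷ q) = q⊆p∧∣p─q∣≡0≡q≟p p q

  below-zero : ∀ n → below {suc n} zero ≡ ⊥
  below-zero zero    = refl
  below-zero (suc n) = cong (false ∷_) (below-zero n)

  ∣p∩below0∣≡0 : ∀ {n} (p : Subset (suc n)) → ∣ p ∩ below zero ∣ ≡ 0
  ∣p∩below0∣≡0 {n} p = trans (cong (λ q → ∣ p ∩ q ∣) (below-zero n)) (trans (cong ∣_∣ (∩-zeroʳ p)) (∣⊥∣≡0 (suc n)))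

  foldr-allFin-suc : ∀ {b} {B : Set b} n (g : Fin (suc n) → B → B) (z : B) →
                     foldr g z (allFin (suc n)) ≡ g zero (foldr (g ∘ suc) z (allFin n))
  foldr-allFin-suc n g z =
    cong (g zero) (trans (cong (foldr g z) (sym (map-tabulate id suc))) (foldr-map g suc z (allFin n)))

  -- `inversions σ η` unfolds to `∑ᴺ[ (λ i → ∣ η ∩ below i ∣) ∈ σ ─ η ]`.
  ∑ᴺ[_∈_] : ∀ {n} → (Fin n → ℕ) → Subset n → ℕ
  ∑ᴺ[_∈_] {n} f p = foldr (λ i acc → (if i ∈ᵇ p then f i else 0) + acc) 0 (allFin n)

  ∑ᴺ-∷ : ∀ {n} (f : Fin (suc n) → ℕ) b (p : Subset n) →
         ∑ᴺ[ f ∈ b ∷ p ] ≡ (if b then f zero else 0) + ∑ᴺ[ f ∘ suc ∈ p ]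
  ∑ᴺ-∷ {n} f true  p = foldr-allFin-suc n (λ i acc → (if i ∈ᵇ (true ∷ p) then f i else 0) + acc) 0
  ∑ᴺ-∷ {n} f false p = foldr-allFin-suc n (λ i acc → (if i ∈ᵇ (false ∷ p) then f i else 0) + acc) 0

  ∑ᴺ-suc : ∀ {n} (f : Fin n → ℕ) (p : Subset n) → ∑ᴺ[ suc ∘ f ∈ p ] ≡ ∑ᴺ[ f ∈ p ] + ∣ p ∣
  ∑ᴺ-suc {zero}  f []          = refl
  ∑ᴺ-suc {suc n} f (false ∷ p) = begin
    ∑ᴺ[ suc ∘ f ∈ false ∷ p ]      ≡⟨ ∑ᴺ-∷ (suc ∘ f) false p ⟩
    ∑ᴺ[ suc ∘ f ∘ suc ∈ p ]        ≡⟨ ∑ᴺ-suc (f ∘ suc) p ⟩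
    ∑ᴺ[ f ∘ suc ∈ p ] + ∣ p ∣       ≡⟨ cong (_+ ∣ p ∣) (∑ᴺ-∷ f false p) ⟨
    ∑ᴺ[ f ∈ false ∷ p ] + ∣ p ∣     ∎
  ∑ᴺ-suc {suc n} f (true ∷ p) = begin
    ∑ᴺ[ suc ∘ f ∈ true ∷ p ]                  ≡⟨ ∑ᴺ-∷ (suc ∘ f) true p ⟩
    suc (f zero) + ∑ᴺ[ suc ∘ f ∘ suc ∈ p ]    ≡⟨ cong (suc (f zero) +_) (∑ᴺ-suc (f ∘ suc) p) ⟩
    suc (f zero) + (∑ᴺ[ f ∘ suc ∈ p ] + ∣ p ∣) ≡⟨ cong suc (+-assoc (f zero) _ _) ⟨
    suc ((f zero + ∑ᴺ[ f ∘ suc ∈ p ]) + ∣ p ∣)  ≡⟨ +-suc (f zero + ∑ᴺ[ f ∘ suc ∈ p ]) ∣ p ∣ ⟨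
    (f zero + ∑ᴺ[ f ∘ suc ∈ p ]) + suc ∣ p ∣   ≡⟨ cong (_+ suc ∣ p ∣) (∑ᴺ-∷ f true p) ⟨
    ∑ᴺ[ f ∈ true ∷ p ] + suc ∣ p ∣             ∎

  inversions-∷-outside : ∀ {n} s (σ η : Subset n) → inversions (s ∷ σ) (false ∷ η) ≡ inversions σ η
  inversions-∷-outside false σ η = ∑ᴺ-∷ (λ i → ∣ (false ∷ η) ∩ below i ∣) false (σ ─ η)
  inversions-∷-outside true  σ η =
    trans (∑ᴺ-∷ (λ i → ∣ (false ∷ η) ∩ below i ∣) true (σ ─ η))
          (cong (_+ inversions σ η) (∣p∩below0∣≡0 (false ∷ η)))

  inversions-∷-inside : ∀ {n} s (σ η : Subset n) →
                        inversions (s ∷ σ) (true ∷ η) ≡ inversions σ η + ∣ σ ─ η ∣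
  inversions-∷-inside s σ η =
    trans (∑ᴺ-∷ (λ i → ∣ (true ∷ η) ∩ below i ∣) false (σ ─ η)) (∑ᴺ-suc (λ i → ∣ η ∩ below i ∣) (σ ─ η))

  inversions-self : ∀ {n} (σ : Subset n) → inversions σ σ ≡ 0
  inversions-self []          = refl
  inversions-self (false ∷ σ) = trans (inversions-∷-outside false σ σ) (inversions-self σ)
  inversions-self (true  ∷ σ) =
    trans (inversions-∷-inside true σ σ) (cong₂ _+_ (inversions-self σ) (∣p─p∣≡0 σ))

  inversions-cocycle : ∀ {n} (σ ρ η : Subset n) → η ⊆ᵇ ρ ≡ true → ρ ⊆ᵇ σ ≡ true →
                       inversions (σ ─ η) (ρ ─ η) + inversions σ η ≡ inversions σ ρ + inversions ρ η
  inversions-cocycle []      []          []          _ _ = refl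
  inversions-cocycle (s ∷ σ) (false ∷ ρ) (false ∷ η) η⊆ρ ρ⊆σ = begin
    inversions (s ∷ (σ ─ η)) (false ∷ (ρ ─ η)) + inversions (s ∷ σ) (false ∷ η)
      ≡⟨ cong₂ _+_ (inversions-∷-outside s (σ ─ η) (ρ ─ η)) (inversions-∷-outside s σ η) ⟩
    inversions (σ ─ η) (ρ ─ η) + inversions σ η
      ≡⟨ inversions-cocycle σ ρ η η⊆ρ ρ⊆σ ⟩
    inversions σ ρ + inversions ρ η
      ≡⟨ cong₂ _+_ (inversions-∷-outside s σ ρ) (inversions-∷-outside false ρ η) ⟨
    inversions (s ∷ σ) (false ∷ ρ) + inversions (false ∷ ρ) (false ∷ η) ∎
  inversions-cocycle (true ∷ σ) (true ∷ ρ) (false ∷ η) η⊆ρ ρ⊆σ = begin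
    inversions (true ∷ (σ ─ η)) (true ∷ (ρ ─ η)) + inversions (true ∷ σ) (false ∷ η)
      ≡⟨ cong₂ _+_ (inversions-∷-inside true (σ ─ η) (ρ ─ η)) (inversions-∷-outside true σ η) ⟩
    (inversions (σ ─ η) (ρ ─ η) + ∣ (σ ─ η) ─ (ρ ─ η) ∣) + inversions σ η
      ≡⟨ xy∙z≈xz∙y (inversions (σ ─ η) (ρ ─ η)) _ _ ⟩
    (inversions (σ ─ η) (ρ ─ η) + inversions σ η) + ∣ (σ ─ η) ─ (ρ ─ η) ∣
      ≡⟨ cong₂ _+_ (inversions-cocycle σ ρ η η⊆ρ ρ⊆σ) (cong ∣_∣ (r⊆q⇒[p─r]─[q─r]≡p─q σ ρ η η⊆ρ)) ⟩
    (inversions σ ρ + inversions ρ η) + ∣ σ ─ ρ ∣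
      ≡⟨ xy∙z≈xz∙y (inversions σ ρ) _ _ ⟩
    (inversions σ ρ + ∣ σ ─ ρ ∣) + inversions ρ η
      ≡⟨ cong₂ _+_ (inversions-∷-inside true σ ρ) (inversions-∷-outside true ρ η) ⟨
    inversions (true ∷ σ) (true ∷ ρ) + inversions (true ∷ ρ) (false ∷ η) ∎
  inversions-cocycle (true ∷ σ) (true ∷ ρ) (true ∷ η) η⊆ρ ρ⊆σ = begin
    inversions (false ∷ (σ ─ η)) (false ∷ (ρ ─ η)) + inversions (true ∷ σ) (true ∷ η)
      ≡⟨ cong₂ _+_ (inversions-∷-outside false (σ ─ η) (ρ ─ η)) (inversions-∷-inside true σ η) ⟩
    inversions (σ ─ η) (ρ ─ η) + (inversions σ η + ∣ σ ─ η ∣)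
      ≡⟨ +-assoc (inversions (σ ─ η) (ρ ─ η)) _ _ ⟨
    (inversions (σ ─ η) (ρ ─ η) + inversions σ η) + ∣ σ ─ η ∣
      ≡⟨ cong₂ _+_ (inversions-cocycle σ ρ η η⊆ρ ρ⊆σ) (r⊆q⊆p⇒∣p─r∣≡∣p─q∣+∣q─r∣ σ ρ η η⊆ρ ρ⊆σ) ⟩
    (inversions σ ρ + inversions ρ η) + (∣ σ ─ ρ ∣ + ∣ ρ ─ η ∣)
      ≡⟨ interchange (inversions σ ρ) _ _ _ ⟩
    (inversions σ ρ + ∣ σ ─ ρ ∣) + (inversions ρ η + ∣ ρ ─ η ∣)
      ≡⟨ cong₂ _+_ (inversions-∷-inside true σ ρ) (inversions-∷-inside true ρ η) ⟨
    inversions (true ∷ σ) (true ∷ ρ) + inversions (true ∷ ρ) (true ∷ η) ∎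

  ⋖ᵇ-─ : ∀ {n} (σ ρ η : Subset n) → η ⊆ᵇ ρ ≡ true → η ⊆ᵇ σ ≡ true → (ρ ─ η) ⋖ᵇ (σ ─ η) ≡ ρ ⋖ᵇ σ
  ⋖ᵇ-─ σ ρ η η⊆ρ η⊆σ = cong₂ (λ b p → b ∧ (∣ p ∣ ≡ᵇ 1)) (r⊆p⇒[q─r]⊆[p─r]≡q⊆p σ ρ η η⊆σ)
                                                       (r⊆q⇒[p─r]─[q─r]≡p─q σ ρ η η⊆ρ)

module ListSum {c ℓ} (R : Semiring c ℓ) where

  open Subsets
  open Arithmetic using (+-cancelˡ-≡ᵇ)
  open import Data.Bool using (Bool; true; false; _∧_; if_then_else_)
  open import Data.Bool.Properties using (∧-assoc)
  open import Data.Nat as ℕ using (ℕ; suc; _≡ᵇ_)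
  open import Data.Fin.Subset using (Subset; _─_; _∩_; _∪_; ∣_∣; ⊥)
  open import Data.Vec using ([]; _∷_)
  open import Data.List using (List; []; _∷_; _++_; map; foldr; filterᵇ)
  open import Relation.Binary.PropositionalEquality as ≡ using (_≡_; cong₂)

  open Semiring R
  open import Relation.Binary.Reasoning.Setoid setoid
  open import Algebra.Properties.CommutativeSemigroup +-commutativeSemigroup using (interchange)

  ∑ : ∀ {A : Set} → (A → Carrier) → List A → Carrier
  ∑ f = foldr (λ x acc → f x + acc) 0#

  when : Bool → Carrier → Carrier
  when b x = if b then x else 0#

  ∑-cong : ∀ {A : Set} {f g : A → Carrier} (xs : List A) → (∀ x → f x ≈ g x) → ∑ f xs ≈ ∑ g xs
  ∑-cong []       f≈g = refl
  ∑-cong (x ∷ xs) f≈g = +-cong (f≈g x) (∑-cong xs f≈g)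

  ∑-0 : ∀ {A : Set} (xs : List A) → ∑ (λ _ → 0#) xs ≈ 0#
  ∑-0 []       = refl
  ∑-0 (x ∷ xs) = trans (+-identityˡ _) (∑-0 xs)

  ∑-+ : ∀ {A : Set} (f g : A → Carrier) (xs : List A) → ∑ (λ x → f x + g x) xs ≈ ∑ f xs + ∑ g xs
  ∑-+ f g []       = sym (+-identityˡ 0#)
  ∑-+ f g (x ∷ xs) = trans (+-congˡ (∑-+ f g xs)) (interchange (f x) (g x) (∑ f xs) (∑ g xs))

  ∑-*ˡ : ∀ {A : Set} a (f : A → Carrier) (xs : List A) → a * ∑ f xs ≈ ∑ (λ x → a * f x) xs
  ∑-*ˡ a f []       = zeroʳ a
  ∑-*ˡ a f (x ∷ xs) = trans (distribˡ a (f x) _) (+-congˡ (∑-*ˡ a f xs))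

  ∑-*ʳ : ∀ {A : Set} a (f : A → Carrier) (xs : List A) → ∑ f xs * a ≈ ∑ (λ x → f x * a) xs
  ∑-*ʳ a f []       = zeroˡ a
  ∑-*ʳ a f (x ∷ xs) = trans (distribʳ a (f x) _) (+-congˡ (∑-*ʳ a f xs))

  *-∑-* : ∀ {A : Set} a b (f : A → Carrier) (xs : List A) → a * ∑ f xs * b ≈ ∑ (λ x → a * f x * b) xs
  *-∑-* a b f xs = trans (*-congʳ (∑-*ˡ a f xs)) (∑-*ʳ b (λ x → a * f x) xs)

  ∑-swap : ∀ {A B : Set} (f : A → B → Carrier) (xs : List A) (ys : List B) →
           ∑ (λ x → ∑ (f x) ys) xs ≈ ∑ (λ y → ∑ (λ x → f x y) xs) ys
  ∑-swap f []       ys = sym (∑-0 ys)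
  ∑-swap f (x ∷ xs) ys = trans (+-congˡ (∑-swap f xs ys)) (sym (∑-+ (f x) _ ys))

  ∑-++ : ∀ {A : Set} (f : A → Carrier) (xs ys : List A) → ∑ f (xs ++ ys) ≈ ∑ f xs + ∑ f ys
  ∑-++ f []       ys = sym (+-identityˡ _)
  ∑-++ f (x ∷ xs) ys = trans (+-congˡ (∑-++ f xs ys)) (sym (+-assoc _ _ _))

  ∑-map : ∀ {A B : Set} (f : B → Carrier) (g : A → B) (xs : List A) → ∑ f (map g xs) ≈ ∑ (λ x → f (g x)) xs
  ∑-map f g []       = refl
  ∑-map f g (x ∷ xs) = +-congˡ (∑-map f g xs)

  ∑-allSubsets-suc : ∀ n (f : Subset (suc n) → Carrier) →
                     ∑ f (allSubsets (suc n))
                     ≈ ∑ (λ p → f (true ∷ p)) (allSubsets n) + ∑ (λ p → f (false ∷ p)) (allSubsets n)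
  ∑-allSubsets-suc n f = trans (∑-++ f (map (true ∷_) (allSubsets n)) _)
                               (+-cong (∑-map f (true ∷_) (allSubsets n)) (∑-map f (false ∷_) (allSubsets n)))

  when-cong : ∀ b {x y} → (b ≡ true → x ≈ y) → when b x ≈ when b y
  when-cong true  x≈y = x≈y ≡.refl
  when-cong false x≈y = refl

  when-∧ : ∀ a b x → when (a ∧ b) x ≡ when a (when b x)
  when-∧ true  b x = ≡.refl
  when-∧ false b x = ≡.refl

  *-when : ∀ b a x → a * when b x ≈ when b (a * x)
  *-when true  a x = refl
  *-when false a x = zeroʳ a

  when-* : ∀ b a x → when b x * a ≈ when b (x * a)
  when-* true  a x = refl
  when-* false a x = zeroˡ a

  *-when-* : ∀ b a c x → a * when b x * c ≈ when b (a * x * c)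
  *-when-* b a c x = trans (*-congʳ (*-when b a x)) (when-* b c (a * x))

  ∑-when : ∀ {A : Set} b (f : A → Carrier) (xs : List A) → ∑ (λ x → when b (f x)) xs ≈ when b (∑ f xs)
  ∑-when true  f xs = refl
  ∑-when false f xs = ∑-0 xs

  ∑-filterᵇ : ∀ {A : Set} (p : A → Bool) (f : A → Carrier) (xs : List A) →
              ∑ f (filterᵇ p xs) ≈ ∑ (λ x → when (p x) (f x)) xs
  ∑-filterᵇ p f []       = refl
  ∑-filterᵇ p f (x ∷ xs) with p x
  ... | true  = +-congˡ (∑-filterᵇ p f xs)
  ... | false = trans (∑-filterᵇ p f xs) (sym (+-identityˡ _))

  double-counting : ∀ {A B : Set} (p : A → Bool) (r : A → B → Bool) (g : B → Carrier)
                    (xs : List A) (ys : List B) →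
                    ∑ (λ x → when (p x) (∑ (λ y → when (r x y) (g y)) ys)) xs
                    ≈ ∑ (λ y → ∑ (λ x → when (p x ∧ r x y) 1#) xs * g y) ys
  double-counting p r g xs ys = begin
    ∑ (λ x → when (p x) (∑ (λ y → when (r x y) (g y)) ys)) xs
      ≈⟨ ∑-cong xs (λ x → ∑-when (p x) _ ys) ⟨
    ∑ (λ x → ∑ (λ y → when (p x) (when (r x y) (g y))) ys) xs
      ≈⟨ ∑-swap _ xs ys ⟩
    ∑ (λ y → ∑ (λ x → when (p x) (when (r x y) (g y))) xs) ys
      ≈⟨ ∑-cong ys (λ y → ∑-cong xs (λ x → indicator-* (p x) (r x y) (g y))) ⟨
    ∑ (λ y → ∑ (λ x → when (p x ∧ r x y) 1# * g y) xs) ys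
      ≈⟨ ∑-cong ys (λ y → ∑-*ʳ (g y) _ xs) ⟨
    ∑ (λ y → ∑ (λ x → when (p x ∧ r x y) 1#) xs * g y) ys ∎
    where
    indicator-* : ∀ a b z → when (a ∧ b) 1# * z ≈ when a (when b z)
    indicator-* a b z = begin
      when (a ∧ b) 1# * z   ≈⟨ when-* (a ∧ b) z 1# ⟩
      when (a ∧ b) (1# * z) ≈⟨ when-cong (a ∧ b) (λ _ → *-identityˡ z) ⟩
      when (a ∧ b) z        ≡⟨ when-∧ a b z ⟩
      when a (when b z)     ∎

  ∑-disjoint≈∑-superset : ∀ {n} (η : Subset n) (f : Subset n → Carrier) →
                          ∑ (λ ρ → when ((ρ ∩ η) ≟ˢ ⊥) (f ρ)) (allSubsets n)
                          ≈ ∑ (λ ρ → when (η ⊆ᵇ ρ) (f (ρ ─ η))) (allSubsets n)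
  ∑-disjoint≈∑-superset [] f = refl
  ∑-disjoint≈∑-superset {suc n} (true ∷ η) f = begin
    ∑ (λ ρ → when ((ρ ∩ (true ∷ η)) ≟ˢ ⊥) (f ρ)) (allSubsets (suc n))
      ≈⟨ ∑-allSubsets-suc n _ ⟩
    ∑ (λ _ → 0#) A + ∑ (λ p → when ((p ∩ η) ≟ˢ ⊥) (f (false ∷ p))) A
      ≈⟨ +-comm _ _ ⟩
    ∑ (λ p → when ((p ∩ η) ≟ˢ ⊥) (f (false ∷ p))) A + ∑ (λ _ → 0#) A
      ≈⟨ +-congʳ (∑-disjoint≈∑-superset η (λ p → f (false ∷ p))) ⟩
    ∑ (λ p → when (η ⊆ᵇ p) (f (false ∷ (p ─ η)))) A + ∑ (λ _ → 0#) A
      ≈⟨ ∑-allSubsets-suc n _ ⟨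
    ∑ (λ ρ → when ((true ∷ η) ⊆ᵇ ρ) (f (ρ ─ (true ∷ η)))) (allSubsets (suc n)) ∎
    where A = allSubsets n
  ∑-disjoint≈∑-superset {suc n} (false ∷ η) f = begin
    ∑ (λ ρ → when ((ρ ∩ (false ∷ η)) ≟ˢ ⊥) (f ρ)) (allSubsets (suc n))
      ≈⟨ ∑-allSubsets-suc n _ ⟩
    ∑ (λ p → when ((p ∩ η) ≟ˢ ⊥) (f (true ∷ p))) A + ∑ (λ p → when ((p ∩ η) ≟ˢ ⊥) (f (false ∷ p))) A
      ≈⟨ +-cong (∑-disjoint≈∑-superset η (λ p → f (true ∷ p))) (∑-disjoint≈∑-superset η (λ p → f (false ∷ p))) ⟩
    ∑ (λ p → when (η ⊆ᵇ p) (f (true ∷ (p ─ η)))) A + ∑ (λ p → when (η ⊆ᵇ p) (f (false ∷ (p ─ η)))) A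
      ≈⟨ ∑-allSubsets-suc n _ ⟨
    ∑ (λ ρ → when ((false ∷ η) ⊆ᵇ ρ) (f (ρ ─ (false ∷ η)))) (allSubsets (suc n)) ∎
    where A = allSubsets n

  ∑-link : ∀ {n} (X : Subset n → Bool) (η : Subset n) m (f : Subset n → Carrier) →
           ∑ (λ ρ → when (isFaceOfSize (link X η) m ρ) (f ρ)) (allSubsets n)
           ≈ ∑ (λ ρ → when (η ⊆ᵇ ρ) (when (isFaceOfSize X (∣ η ∣ ℕ.+ m) ρ) (f (ρ ─ η)))) (allSubsets n)
  ∑-link {n} X η m f = begin
    ∑ (λ ρ → when (isFaceOfSize (link X η) m ρ) (f ρ)) A
      ≈⟨ ∑-cong A (λ ρ → reflexive (≡.trans (≡.cong (λ b → when b (f ρ)) (∧-assoc ((ρ ∩ η) ≟ˢ ⊥) _ _))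
                                           (when-∧ ((ρ ∩ η) ≟ˢ ⊥) _ (f ρ)))) ⟩
    ∑ (λ ρ → when ((ρ ∩ η) ≟ˢ ⊥) (when (X (ρ ∪ η) ∧ (∣ ρ ∣ ≡ᵇ m)) (f ρ))) A
      ≈⟨ ∑-disjoint≈∑-superset η (λ ρ → when (X (ρ ∪ η) ∧ (∣ ρ ∣ ≡ᵇ m)) (f ρ)) ⟩
    ∑ (λ ρ → when (η ⊆ᵇ ρ) (when (X ((ρ ─ η) ∪ η) ∧ (∣ ρ ─ η ∣ ≡ᵇ m)) (f (ρ ─ η)))) A
      ≈⟨ ∑-cong A (λ ρ → when-cong (η ⊆ᵇ ρ) (λ η⊆ρ → reflexive
           (cong₂ (λ ρ′ b → when (X ρ′ ∧ b) (f (ρ ─ η))) (q⊆p⇒p─q∪q≡p ρ η η⊆ρ) (size-in-link ρ η⊆ρ)))) ⟩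
    ∑ (λ ρ → when (η ⊆ᵇ ρ) (when (isFaceOfSize X (∣ η ∣ ℕ.+ m) ρ) (f (ρ ─ η)))) A ∎
    where
    A = allSubsets n
    size-in-link : ∀ ρ → η ⊆ᵇ ρ ≡ true → (∣ ρ ─ η ∣ ≡ᵇ m) ≡ (∣ ρ ∣ ≡ᵇ ∣ η ∣ ℕ.+ m)
    size-in-link ρ η⊆ρ = ≡.trans (≡.sym (+-cancelˡ-≡ᵇ ∣ η ∣ ∣ ρ ─ η ∣ m))
                                 (≡.cong (_≡ᵇ ∣ η ∣ ℕ.+ m) (≡.sym (q⊆p⇒∣p∣≡∣q∣+∣p─q∣ ρ η η⊆ρ)))

module Laplacian {c ℓ₀} (F : SqrtField c ℓ₀) where

  open Subsets
  open Arithmetic using (≡ᵇ-true⇒≡)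
  open import Data.Bool using (Bool; true; false; _∧_)
  open import Data.Bool.Properties using (∧-conicalˡ; ∧-conicalʳ; ∧-zeroʳ)
  open import Data.Nat as ℕ using (ℕ; zero; suc; _<_; _≡ᵇ_)
  open import Data.Nat.Combinatorics using (_C_; nCk+nC[k+1]≡[n+1]C[k+1])
  open import Data.Fin using (Fin; zero; suc)
  open import Data.Fin.Subset using (Subset; _─_; _∩_; _∪_; ∣_∣; ⊥)
  import Data.Fin.Subset as Subset
  open import Data.Fin.Subset.Properties using (p─⊥≡p)
  open import Data.Vec using ([]; _∷_)
  open import Data.List using (allFin)
  open import Relation.Binary.PropositionalEquality as ≡ using (_≡_; cong₂)

  open SqrtField F hiding (zero)
  -- `∑` of this instance is definitionally `sumL F`.
  open ListSum semiring public
  open import Relation.Binary.Reasoning.Setoid setoid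
  open import Algebra.Properties.Ring ring using (-1*x≈-x; -‿distribˡ-*; -‿distribʳ-*; -‿involutive)
  open import Algebra.Properties.CommutativeSemigroup *-commutativeSemigroup using (interchange)
  import Algebra.Solver.CommutativeMonoid *-commutativeMonoid as ×

  sign-+ : ∀ a b → sign F (a ℕ.+ b) ≈ sign F a * sign F b
  sign-+ zero    b = sym (*-identityˡ _)
  sign-+ (suc a) b = trans (-‿cong (sign-+ a b)) (-‿distribˡ-* _ _)

  sign*sign≈1 : ∀ a → sign F a * sign F a ≈ 1#
  sign*sign≈1 zero    = *-identityˡ 1#
  sign*sign≈1 (suc a) = begin
    (- sign F a) * (- sign F a) ≈⟨ -‿distribˡ-* _ _ ⟨
    - (sign F a * - sign F a)   ≈⟨ -‿cong (-‿distribʳ-* _ _) ⟨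
    - - (sign F a * sign F a)   ≈⟨ -‿involutive _ ⟩
    sign F a * sign F a         ≈⟨ sign*sign≈1 a ⟩
    1#                          ∎

  fromℕ-+ : ∀ a b → fromℕ F (a ℕ.+ b) ≈ fromℕ F a + fromℕ F b
  fromℕ-+ zero    b = sym (+-identityˡ _)
  fromℕ-+ (suc a) b = trans (+-congˡ (fromℕ-+ a b)) (sym (+-assoc _ _ _))

  fromℕ-* : ∀ a b → fromℕ F (a ℕ.* b) ≈ fromℕ F a * fromℕ F b
  fromℕ-* zero    b = sym (zeroˡ _)
  fromℕ-* (suc a) b = begin
    fromℕ F (b ℕ.+ a ℕ.* b)              ≈⟨ fromℕ-+ b (a ℕ.* b) ⟩
    fromℕ F b + fromℕ F (a ℕ.* b)        ≈⟨ +-cong (sym (*-identityˡ _)) (fromℕ-* a b) ⟩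
    1# * fromℕ F b + fromℕ F a * fromℕ F b ≈⟨ distribʳ _ _ _ ⟨
    (1# + fromℕ F a) * fromℕ F b         ∎

  fromℕ-pos : ∀ {m} → 0 < m → Pos (fromℕ F m)
  fromℕ-pos {suc zero}    _ = Pos-resp (sym (+-identityʳ 1#)) Pos-1
  fromℕ-pos {suc (suc m)} _ = Pos-+ Pos-1 (fromℕ-pos {suc m} (ℕ.s≤s ℕ.z≤n))

  inv-sqrt²* : ∀ {x} → Pos x → inv (sqrt x) * inv (sqrt x) * x ≈ 1#
  inv-sqrt²* {x} x>0 = begin
    inv (sqrt x) * inv (sqrt x) * x                    ≈⟨ *-congˡ (sqrt-sq x>0) ⟨
    inv (sqrt x) * inv (sqrt x) * (sqrt x * sqrt x)    ≈⟨ interchange _ _ _ _ ⟩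
    (inv (sqrt x) * sqrt x) * (inv (sqrt x) * sqrt x)  ≈⟨ *-cong (*-comm _ _) (*-comm _ _) ⟩
    (sqrt x * inv (sqrt x)) * (sqrt x * inv (sqrt x))  ≈⟨ *-cong (inv-r (sqrt-pos x>0)) (inv-r (sqrt-pos x>0)) ⟩
    1# * 1#                                            ≈⟨ *-identityˡ 1# ⟩
    1#                                                 ∎

  bd-term : ∀ {n} → Subset n → Subset n → Fin n → Carrier
  bd-term ρ σ u = when ((u ∈ᵇ σ) ∧ (ρ ≟ˢ (σ Subset.- u))) (sign F ∣ σ ∩ below u ∣)

  bd-∷ : ∀ {n} r s (ρ σ : Subset n) →
         bd F (r ∷ ρ) (s ∷ σ) ≡ bd-term (r ∷ ρ) (s ∷ σ) zero + ∑ (λ u → bd-term (r ∷ ρ) (s ∷ σ) (suc u)) (allFin n)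
  bd-∷ {n} r s ρ σ = foldr-allFin-suc n (λ u acc → bd-term (r ∷ ρ) (s ∷ σ) u + acc) 0#

  ∑-when-∧false : ∀ {A : Set} (p : A → Bool) (f : A → Carrier) xs → ∑ (λ x → when (p x ∧ false) (f x)) xs ≈ 0#
  ∑-when-∧false p f xs = trans (∑-cong xs (λ x → reflexive (≡.cong (λ b → when b (f x)) (∧-zeroʳ (p x))))) (∑-0 xs)

  bd-false∷-false∷ : ∀ {n} (ρ σ : Subset n) → bd F (false ∷ ρ) (false ∷ σ) ≈ bd F ρ σ
  bd-false∷-false∷ ρ σ = trans (reflexive (bd-∷ false false ρ σ)) (+-identityˡ _)

  bd-true∷-false∷ : ∀ {n} (ρ σ : Subset n) → bd F (true ∷ ρ) (false ∷ σ) ≈ 0#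
  bd-true∷-false∷ ρ σ =
    trans (reflexive (bd-∷ true false ρ σ)) (trans (+-identityˡ _) (∑-when-∧false (_∈ᵇ σ) _ (allFin _)))

  bd-false∷-true∷ : ∀ {n} (ρ σ : Subset n) → bd F (false ∷ ρ) (true ∷ σ) ≈ when (ρ ≟ˢ σ) 1#
  bd-false∷-true∷ ρ σ = begin
    bd F (false ∷ ρ) (true ∷ σ)
      ≡⟨ bd-∷ false true ρ σ ⟩
    when (ρ ≟ˢ (σ ─ ⊥)) (sign F ∣ (true ∷ σ) ∩ below zero ∣) + _
      ≈⟨ +-congˡ (∑-when-∧false (_∈ᵇ σ) _ (allFin _)) ⟩
    when (ρ ≟ˢ (σ ─ ⊥)) (sign F ∣ (true ∷ σ) ∩ below zero ∣) + 0#
      ≈⟨ +-identityʳ _ ⟩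
    when (ρ ≟ˢ (σ ─ ⊥)) (sign F ∣ (true ∷ σ) ∩ below zero ∣)
      ≡⟨ cong₂ (λ p i → when (ρ ≟ˢ p) (sign F i)) (p─⊥≡p σ) (∣p∩below0∣≡0 (true ∷ σ)) ⟩
    when (ρ ≟ˢ σ) 1# ∎

  bd-true∷-true∷ : ∀ {n} (ρ σ : Subset n) → bd F (true ∷ ρ) (true ∷ σ) ≈ - 1# * bd F ρ σ
  bd-true∷-true∷ {n} ρ σ = begin
    bd F (true ∷ ρ) (true ∷ σ)                                     ≡⟨ bd-∷ true true ρ σ ⟩
    0# + ∑ (λ u → bd-term (true ∷ ρ) (true ∷ σ) (suc u)) (allFin n) ≈⟨ +-identityˡ _ ⟩
    ∑ (λ u → bd-term (true ∷ ρ) (true ∷ σ) (suc u)) (allFin n)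
      ≈⟨ ∑-cong (allFin n) (λ u → trans (when-cong _ (λ _ → sym (-1*x≈-x _))) (sym (*-when _ _ _))) ⟩
    ∑ (λ u → - 1# * bd-term ρ σ u) (allFin n)                       ≈⟨ ∑-*ˡ (- 1#) (bd-term ρ σ) (allFin n) ⟨
    - 1# * bd F ρ σ                                                 ∎

  bd≈when-⋖ : ∀ {n} (ρ σ : Subset n) → bd F ρ σ ≈ when (ρ ⋖ᵇ σ) (sign F (inversions σ ρ))
  bd≈when-⋖ []          []          = refl
  bd≈when-⋖ (true  ∷ ρ) (false ∷ σ) = bd-true∷-false∷ ρ σ
  bd≈when-⋖ (false ∷ ρ) (false ∷ σ) = begin
    bd F (false ∷ ρ) (false ∷ σ)             ≈⟨ bd-false∷-false∷ ρ σ ⟩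
    bd F ρ σ                                 ≈⟨ bd≈when-⋖ ρ σ ⟩
    when (ρ ⋖ᵇ σ) (sign F (inversions σ ρ))
      ≡⟨ ≡.cong (λ i → when (ρ ⋖ᵇ σ) (sign F i)) (inversions-∷-outside false σ ρ) ⟨
    when (ρ ⋖ᵇ σ) (sign F (inversions (false ∷ σ) (false ∷ ρ))) ∎
  bd≈when-⋖ (false ∷ ρ) (true ∷ σ) = begin
    bd F (false ∷ ρ) (true ∷ σ)              ≈⟨ bd-false∷-true∷ ρ σ ⟩
    when (ρ ≟ˢ σ) 1#
      ≈⟨ when-cong (ρ ≟ˢ σ) (λ ρ≡σ → reflexive (≡.cong (sign F)
           (≡.sym (≡.trans (≡.cong (inversions σ) (≟ˢ⇒≡ ρ≡σ)) (inversions-self σ))))) ⟩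
    when (ρ ≟ˢ σ) (sign F (inversions σ ρ))
      ≡⟨ cong₂ (λ b i → when b (sign F i)) (q⊆p∧∣p─q∣≡0≡q≟p σ ρ) (inversions-∷-outside true σ ρ) ⟨
    when ((false ∷ ρ) ⋖ᵇ (true ∷ σ)) (sign F (inversions (true ∷ σ) (false ∷ ρ))) ∎
  bd≈when-⋖ (true ∷ ρ) (true ∷ σ) = begin
    bd F (true ∷ ρ) (true ∷ σ)                      ≈⟨ bd-true∷-true∷ ρ σ ⟩
    - 1# * bd F ρ σ                                 ≈⟨ *-congˡ (bd≈when-⋖ ρ σ) ⟩
    - 1# * when (ρ ⋖ᵇ σ) (sign F (inversions σ ρ))  ≈⟨ *-when (ρ ⋖ᵇ σ) _ _ ⟩
    when (ρ ⋖ᵇ σ) (- 1# * sign F (inversions σ ρ))  ≈⟨ when-cong (ρ ⋖ᵇ σ) flip-sign ⟩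
    when (ρ ⋖ᵇ σ) (sign F (inversions σ ρ ℕ.+ ∣ σ ─ ρ ∣))
      ≡⟨ ≡.cong (λ i → when (ρ ⋖ᵇ σ) (sign F i)) (inversions-∷-inside true σ ρ) ⟨
    when (ρ ⋖ᵇ σ) (sign F (inversions (true ∷ σ) (true ∷ ρ))) ∎
    where
    flip-sign : ρ ⋖ᵇ σ ≡ true → - 1# * sign F (inversions σ ρ) ≈ sign F (inversions σ ρ ℕ.+ ∣ σ ─ ρ ∣)
    flip-sign ρ⋖σ = begin
      - 1# * sign F (inversions σ ρ)         ≈⟨ *-comm _ _ ⟩
      sign F (inversions σ ρ) * sign F 1     ≈⟨ sign-+ (inversions σ ρ) 1 ⟨
      sign F (inversions σ ρ ℕ.+ 1)          ≡⟨ ≡.cong (λ j → sign F (inversions σ ρ ℕ.+ j))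
                                                  (≡ᵇ-true⇒≡ ∣ σ ─ ρ ∣ 1 (∧-conicalʳ (ρ ⊆ᵇ σ) _ ρ⋖σ)) ⟨
      sign F (inversions σ ρ ℕ.+ ∣ σ ─ ρ ∣)  ∎

  bd-link : ∀ {n} (σ ρ η : Subset n) → η ⊆ᵇ ρ ≡ true → η ⊆ᵇ σ ≡ true →
            bd F (ρ ─ η) (σ ─ η) * sign F (inversions σ η) ≈ bd F ρ σ * sign F (inversions ρ η)
  bd-link σ ρ η η⊆ρ η⊆σ = begin
    bd F (ρ ─ η) (σ ─ η) * sign F (inversions σ η)
      ≈⟨ *-congʳ (bd≈when-⋖ (ρ ─ η) (σ ─ η)) ⟩
    when ((ρ ─ η) ⋖ᵇ (σ ─ η)) (sign F (inversions (σ ─ η) (ρ ─ η))) * sign F (inversions σ η)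
      ≡⟨ ≡.cong (λ b → when b (sign F (inversions (σ ─ η) (ρ ─ η))) * sign F (inversions σ η)) (⋖ᵇ-─ σ ρ η η⊆ρ η⊆σ) ⟩
    when (ρ ⋖ᵇ σ) (sign F (inversions (σ ─ η) (ρ ─ η))) * sign F (inversions σ η)
      ≈⟨ when-* (ρ ⋖ᵇ σ) _ _ ⟩
    when (ρ ⋖ᵇ σ) (sign F (inversions (σ ─ η) (ρ ─ η)) * sign F (inversions σ η))
      ≈⟨ when-cong (ρ ⋖ᵇ σ) (λ ρ⋖σ → cocycle (∧-conicalˡ (ρ ⊆ᵇ σ) _ ρ⋖σ)) ⟩
    when (ρ ⋖ᵇ σ) (sign F (inversions σ ρ) * sign F (inversions ρ η))
      ≈⟨ when-* (ρ ⋖ᵇ σ) _ _ ⟨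
    when (ρ ⋖ᵇ σ) (sign F (inversions σ ρ)) * sign F (inversions ρ η)
      ≈⟨ *-congʳ (bd≈when-⋖ ρ σ) ⟨
    bd F ρ σ * sign F (inversions ρ η) ∎
    where
    cocycle : ρ ⊆ᵇ σ ≡ true →
              sign F (inversions (σ ─ η) (ρ ─ η)) * sign F (inversions σ η)
              ≈ sign F (inversions σ ρ) * sign F (inversions ρ η)
    cocycle ρ⊆σ = begin
      sign F (inversions (σ ─ η) (ρ ─ η)) * sign F (inversions σ η) ≈⟨ sign-+ (inversions (σ ─ η) (ρ ─ η)) _ ⟨
      sign F (inversions (σ ─ η) (ρ ─ η) ℕ.+ inversions σ η)       ≡⟨ ≡.cong (sign F) (inversions-cocycle σ ρ η η⊆ρ ρ⊆σ) ⟩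
      sign F (inversions σ ρ ℕ.+ inversions ρ η)                   ≈⟨ sign-+ (inversions σ ρ) _ ⟩
      sign F (inversions σ ρ) * sign F (inversions ρ η)            ∎

  bd-vanishes : ∀ {n} (ρ σ : Subset n) → ρ ⊆ᵇ σ ≡ false → bd F ρ σ ≈ 0#
  bd-vanishes ρ σ ρ⊈σ =
    trans (bd≈when-⋖ ρ σ) (reflexive (≡.cong (λ b → when (b ∧ (∣ σ ─ ρ ∣ ≡ᵇ 1)) (sign F (inversions σ ρ))) ρ⊈σ))

  ∑-subsets-of-size : ∀ {n} (ρ : Subset n) m →
                      ∑ (λ η → when (η ⊆ᵇ ρ ∧ (∣ η ∣ ≡ᵇ m)) 1#) (allSubsets n) ≈ fromℕ F (∣ ρ ∣ C m)
  ∑-subsets-of-size []          zero    = refl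
  ∑-subsets-of-size []          (suc m) = +-identityˡ 0#
  ∑-subsets-of-size {suc n} (false ∷ ρ) m = begin
    ∑ (λ η → when (η ⊆ᵇ (false ∷ ρ) ∧ (∣ η ∣ ≡ᵇ m)) 1#) (allSubsets (suc n))
      ≈⟨ ∑-allSubsets-suc n _ ⟩
    ∑ (λ _ → 0#) (allSubsets n) + ∑ (λ η → when (η ⊆ᵇ ρ ∧ (∣ η ∣ ≡ᵇ m)) 1#) (allSubsets n)
      ≈⟨ +-cong (∑-0 (allSubsets n)) (∑-subsets-of-size ρ m) ⟩
    0# + fromℕ F (∣ ρ ∣ C m)
      ≈⟨ +-identityˡ _ ⟩
    fromℕ F (∣ ρ ∣ C m) ∎
  ∑-subsets-of-size {suc n} (true ∷ ρ) zero = begin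
    ∑ (λ η → when (η ⊆ᵇ (true ∷ ρ) ∧ (∣ η ∣ ≡ᵇ 0)) 1#) (allSubsets (suc n))
      ≈⟨ ∑-allSubsets-suc n _ ⟩
    ∑ (λ η → when (η ⊆ᵇ ρ ∧ false) 1#) (allSubsets n) + ∑ (λ η → when (η ⊆ᵇ ρ ∧ (∣ η ∣ ≡ᵇ 0)) 1#) (allSubsets n)
      ≈⟨ +-cong (∑-when-∧false (_⊆ᵇ ρ) _ (allSubsets n)) (∑-subsets-of-size ρ 0) ⟩
    0# + fromℕ F (∣ ρ ∣ C 0)
      ≈⟨ +-identityˡ _ ⟩
    fromℕ F (suc ∣ ρ ∣ C 0) ∎
  ∑-subsets-of-size {suc n} (true ∷ ρ) (suc m) = begin
    ∑ (λ η → when (η ⊆ᵇ (true ∷ ρ) ∧ (∣ η ∣ ≡ᵇ suc m)) 1#) (allSubsets (suc n))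
      ≈⟨ ∑-allSubsets-suc n _ ⟩
    ∑ (λ η → when (η ⊆ᵇ ρ ∧ (∣ η ∣ ≡ᵇ m)) 1#) (allSubsets n)
      + ∑ (λ η → when (η ⊆ᵇ ρ ∧ (∣ η ∣ ≡ᵇ suc m)) 1#) (allSubsets n)
      ≈⟨ +-cong (∑-subsets-of-size ρ m) (∑-subsets-of-size ρ (suc m)) ⟩
    fromℕ F (∣ ρ ∣ C m) + fromℕ F (∣ ρ ∣ C suc m)
      ≈⟨ fromℕ-+ (∣ ρ ∣ C m) _ ⟨
    fromℕ F (∣ ρ ∣ C m ℕ.+ ∣ ρ ∣ C suc m)
      ≡⟨ ≡.cong (fromℕ F) (nCk+nC[k+1]≡[n+1]C[k+1] ∣ ρ ∣ m) ⟩
    fromℕ F (suc ∣ ρ ∣ C suc m) ∎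

  Ldown-term : ∀ {n} → (Subset n → Carrier) → Subset n → Subset n → Subset n → Carrier
  Ldown-term w σ τ ρ = sqrt (w σ) * (bd F ρ σ * inv (w ρ) * bd F ρ τ) * sqrt (w τ)

  Ldown≈∑ : ∀ {n} (X : Subset n → Bool) (w : Subset n → Carrier) k (σ τ : Subset n) →
            Ldown F X w k σ τ ≈ ∑ (λ ρ → when (isFaceOfSize X k ρ) (Ldown-term w σ τ ρ)) (allSubsets n)
  Ldown≈∑ {n} X w k σ τ = begin
    sqrt (w σ) * ∑ g (facesOfSize X k) * sqrt (w τ)
      ≈⟨ *-congʳ (*-congˡ (∑-filterᵇ (isFaceOfSize X k) g (allSubsets n))) ⟩
    sqrt (w σ) * ∑ (λ ρ → when (isFaceOfSize X k ρ) (g ρ)) (allSubsets n) * sqrt (w τ)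
      ≈⟨ *-∑-* (sqrt (w σ)) (sqrt (w τ)) _ (allSubsets n) ⟩
    ∑ (λ ρ → sqrt (w σ) * when (isFaceOfSize X k ρ) (g ρ) * sqrt (w τ)) (allSubsets n)
      ≈⟨ ∑-cong (allSubsets n) (λ ρ → *-when-* (isFaceOfSize X k ρ) _ _ (g ρ)) ⟩
    ∑ (λ ρ → when (isFaceOfSize X k ρ) (Ldown-term w σ τ ρ)) (allSubsets n) ∎
    where
    g : Subset n → Carrier
    g ρ = bd F ρ σ * inv (w ρ) * bd F ρ τ

  Ldown-term-link : ∀ {n} (w : Subset n → Carrier) {σ τ ρ η : Subset n} →
                    η ⊆ᵇ σ ≡ true → η ⊆ᵇ τ ≡ true → η ⊆ᵇ ρ ≡ true →
                    sign F (inversions σ η) * sign F (inversions τ η)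
                      * Ldown-term (λ p → w (p ∪ η)) (σ ─ η) (τ ─ η) (ρ ─ η)
                    ≈ Ldown-term w σ τ ρ
  Ldown-term-link w {σ} {τ} {ρ} {η} η⊆σ η⊆τ η⊆ρ = begin
    s₁ * s₂ * (sqrt (w ((σ ─ η) ∪ η)) * (B₁ * inv (w ((ρ ─ η) ∪ η)) * B₂) * sqrt (w ((τ ─ η) ∪ η)))
      ≈⟨ *-congˡ (*-cong (*-cong (sqrt-cong (w-∪ η⊆σ)) (*-congʳ (*-congˡ (inv-cong (w-∪ η⊆ρ)))))
                         (sqrt-cong (w-∪ η⊆τ))) ⟩
    s₁ * s₂ * (a * (B₁ * i * B₂) * b)
      ≈⟨ ×.solve 7 (λ s₁ s₂ a B₁ i B₂ b →
           (s₁ ×.⊕ s₂) ×.⊕ ((a ×.⊕ ((B₁ ×.⊕ i) ×.⊕ B₂)) ×.⊕ b)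
           ×.⊜ (a ×.⊕ (((B₁ ×.⊕ s₁) ×.⊕ i) ×.⊕ (B₂ ×.⊕ s₂))) ×.⊕ b) refl s₁ s₂ a B₁ i B₂ b ⟩
    a * ((B₁ * s₁) * i * (B₂ * s₂)) * b
      ≈⟨ *-congʳ (*-congˡ (*-cong (*-congʳ (bd-link σ ρ η η⊆ρ η⊆σ)) (bd-link τ ρ η η⊆ρ η⊆τ))) ⟩
    a * ((b₁ * sρ) * i * (b₂ * sρ)) * b
      ≈⟨ ×.solve 6 (λ a b₁ sρ i b₂ b →
           (a ×.⊕ (((b₁ ×.⊕ sρ) ×.⊕ i) ×.⊕ (b₂ ×.⊕ sρ))) ×.⊕ b
           ×.⊜ ((a ×.⊕ ((b₁ ×.⊕ i) ×.⊕ b₂)) ×.⊕ b) ×.⊕ (sρ ×.⊕ sρ)) refl a b₁ sρ i b₂ b ⟩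
    Ldown-term w σ τ ρ * (sρ * sρ)
      ≈⟨ *-congˡ (sign*sign≈1 (inversions ρ η)) ⟩
    Ldown-term w σ τ ρ * 1#
      ≈⟨ *-identityʳ _ ⟩
    Ldown-term w σ τ ρ ∎
    where
    s₁ = sign F (inversions σ η)
    s₂ = sign F (inversions τ η)
    sρ = sign F (inversions ρ η)
    a = sqrt (w σ)
    b = sqrt (w τ)
    i = inv (w ρ)
    B₁ = bd F (ρ ─ η) (σ ─ η)
    B₂ = bd F (ρ ─ η) (τ ─ η)
    b₁ = bd F ρ σ
    b₂ = bd F ρ τ
    w-∪ : ∀ {p} → η ⊆ᵇ p ≡ true → w ((p ─ η) ∪ η) ≈ w p
    w-∪ {p} η⊆p = reflexive (≡.cong w (q⊆p⇒p─q∪q≡p p η η⊆p))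

  Ldown-link : ∀ {n} (X : Subset n → Bool) (w : Subset n → Carrier) m {σ τ η : Subset n} →
               η ⊆ᵇ σ ≡ true → η ⊆ᵇ τ ≡ true →
               sign F (inversions σ η) * sign F (inversions τ η) * Ldown F (link X η) (λ p → w (p ∪ η)) m (σ ─ η) (τ ─ η)
               ≈ ∑ (λ ρ → when (η ⊆ᵇ ρ) (when (isFaceOfSize X (∣ η ∣ ℕ.+ m) ρ) (Ldown-term w σ τ ρ))) (allSubsets n)
  Ldown-link {n} X w m {σ} {τ} {η} η⊆σ η⊆τ = begin
    s * Ldown F (link X η) w′ m (σ ─ η) (τ ─ η)
      ≈⟨ *-congˡ (Ldown≈∑ (link X η) w′ m (σ ─ η) (τ ─ η)) ⟩
    s * ∑ (λ ρ → when (isFaceOfSize (link X η) m ρ) (T′ ρ)) A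
      ≈⟨ *-congˡ (∑-link X η m T′) ⟩
    s * ∑ (λ ρ → when (η ⊆ᵇ ρ) (when (isFaceOfSize X (∣ η ∣ ℕ.+ m) ρ) (T′ (ρ ─ η)))) A
      ≈⟨ ∑-*ˡ s _ A ⟩
    ∑ (λ ρ → s * when (η ⊆ᵇ ρ) (when (isFaceOfSize X (∣ η ∣ ℕ.+ m) ρ) (T′ (ρ ─ η)))) A
      ≈⟨ ∑-cong A (λ ρ → trans (*-when (η ⊆ᵇ ρ) s _) (when-cong (η ⊆ᵇ ρ) (λ η⊆ρ →
           trans (*-when (isFaceOfSize X (∣ η ∣ ℕ.+ m) ρ) s _)
                 (when-cong (isFaceOfSize X (∣ η ∣ ℕ.+ m) ρ) (λ _ → Ldown-term-link w η⊆σ η⊆τ η⊆ρ))))) ⟩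
    ∑ (λ ρ → when (η ⊆ᵇ ρ) (when (isFaceOfSize X (∣ η ∣ ℕ.+ m) ρ) (Ldown-term w σ τ ρ))) A ∎
    where
    A = allSubsets n
    s = sign F (inversions σ η) * sign F (inversions τ η)
    w′ : Subset n → Carrier
    w′ p = w (p ∪ η)
    T′ : Subset n → Carrier
    T′ = Ldown-term w′ (σ ─ η) (τ ─ η)

  Ldown-term-vanishesˡ : ∀ {n} (w : Subset n → Carrier) {σ τ ρ : Subset n} → ρ ⊆ᵇ σ ≡ false → Ldown-term w σ τ ρ ≈ 0#
  Ldown-term-vanishesˡ w {σ} {τ} {ρ} ρ⊈σ = begin
    sqrt (w σ) * (bd F ρ σ * inv (w ρ) * bd F ρ τ) * sqrt (w τ)
      ≈⟨ *-congʳ (*-congˡ (*-congʳ (*-congʳ (bd-vanishes ρ σ ρ⊈σ)))) ⟩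
    sqrt (w σ) * (0# * inv (w ρ) * bd F ρ τ) * sqrt (w τ)
      ≈⟨ *-congʳ (*-congˡ (trans (*-congʳ (zeroˡ _)) (zeroˡ _))) ⟩
    sqrt (w σ) * 0# * sqrt (w τ)
      ≈⟨ trans (*-congʳ (zeroʳ _)) (zeroˡ _) ⟩
    0# ∎

  Ldown-term-vanishesʳ : ∀ {n} (w : Subset n → Carrier) {σ τ ρ : Subset n} → ρ ⊆ᵇ τ ≡ false → Ldown-term w σ τ ρ ≈ 0#
  Ldown-term-vanishesʳ w {σ} {τ} {ρ} ρ⊈τ = begin
    sqrt (w σ) * (bd F ρ σ * inv (w ρ) * bd F ρ τ) * sqrt (w τ)
      ≈⟨ *-congʳ (*-congˡ (*-congˡ (bd-vanishes ρ τ ρ⊈τ))) ⟩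
    sqrt (w σ) * (bd F ρ σ * inv (w ρ) * 0#) * sqrt (w τ)
      ≈⟨ *-congʳ (*-congˡ (zeroʳ _)) ⟩
    sqrt (w σ) * 0# * sqrt (w τ)
      ≈⟨ trans (*-congʳ (zeroʳ _)) (zeroˡ _) ⟩
    0# ∎

module LinkSum {c ℓ₀} (F : SqrtField c ℓ₀) {n} (X : SimplicialComplex n) (w : Subset n → SqrtField.Carrier F)
               {ℓ k : ℕ} (ℓ<k : ℓ < k) (σ τ : Subset n) where

  open Arithmetic
  open Subsets
  open Laplacian F
  open SqrtField F hiding (zero)
  open import Data.Bool using (Bool; false)
  open import Data.Bool.Properties using (∧-conicalˡ; ∧-conicalʳ; ∧-zeroʳ; ∧-identityʳ)
  open import Data.Nat using (_≡ᵇ_; s≤s)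
  import Data.Nat as ℕ
  open import Data.Nat.Properties using (<⇒≤)
  open import Data.Nat.Combinatorics using (_C_)
  import Relation.Binary.PropositionalEquality as ≡
  open import Algebra.Properties.CommutativeSemigroup *-commutativeSemigroup using (x∙yz≈y∙zx; x∙yz≈y∙xz)
  import Algebra.Solver.CommutativeMonoid *-commutativeMonoid as ×
  open SetoidReasoning setoid

  A = allSubsets n

  isℓFace isFacet ⊆σ∧⊆τ isCommonℓFace : Subset n → Bool
  isℓFace = isFaceOfSize (face X) (suc ℓ)
  isFacet = isFaceOfSize (face X) k
  ⊆σ∧⊆τ η = (η ⊆ᵇ σ) ∧ (η ⊆ᵇ τ)
  isCommonℓFace η = isℓFace η ∧ ⊆σ∧⊆τ η

  summand : Subset n → Carrier
  summand η = sη F ℓ k η σ * sη F ℓ k η τ * fromℕ F (suc k) * Leta F (face X) w ℓ k η σ τ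

  c₀ scale : Carrier
  c₀ = inv (sqrt (fromℕ F (suc k C suc ℓ)))
  scale = c₀ * c₀ * fromℕ F (suc k)

  scaledTerm : Subset n → Carrier
  scaledTerm ρ = scale * when (isFacet ρ) (Ldown-term w σ τ ρ)

  [kCℓ+1]*scale≈k∸ℓ : fromℕ F (k C suc ℓ) * scale ≈ fromℕ F (k ∸ ℓ)
  [kCℓ+1]*scale≈k∸ℓ = begin
    fromℕ F (k C suc ℓ) * (c₀ * c₀ * fromℕ F (suc k))   ≈⟨ x∙yz≈y∙zx _ (c₀ * c₀) _ ⟩
    c₀ * c₀ * (fromℕ F (suc k) * fromℕ F (k C suc ℓ))   ≈⟨ *-congˡ (fromℕ-* (suc k) (k C suc ℓ)) ⟨
    c₀ * c₀ * fromℕ F (suc k ℕ.* (k C suc ℓ))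
      ≡⟨ ≡.cong (λ m → c₀ * c₀ * fromℕ F m) ([n+1]*nC[k+1]≡[n∸k]*[n+1]C[k+1] ℓ<k) ⟩
    c₀ * c₀ * fromℕ F ((k ∸ ℓ) ℕ.* (suc k C suc ℓ))     ≈⟨ *-congˡ (fromℕ-* (k ∸ ℓ) _) ⟩
    c₀ * c₀ * (fromℕ F (k ∸ ℓ) * fromℕ F (suc k C suc ℓ)) ≈⟨ x∙yz≈y∙xz (c₀ * c₀) _ _ ⟩
    fromℕ F (k ∸ ℓ) * (c₀ * c₀ * fromℕ F (suc k C suc ℓ)) ≈⟨ *-congˡ (inv-sqrt²* (fromℕ-pos (0<nCk (s≤s (<⇒≤ ℓ<k))))) ⟩
    fromℕ F (k ∸ ℓ) * 1#                                ≈⟨ *-identityʳ _ ⟩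
    fromℕ F (k ∸ ℓ)                                     ∎

  summand≈∑ : ∀ {η} → isℓFace η ≡ true → ⊆σ∧⊆τ η ≡ true → summand η ≈ ∑ (λ ρ → when (η ⊆ᵇ ρ) (scaledTerm ρ)) A
  summand≈∑ {η} η∈X η⊆σ∧τ = begin
    (c₀ * s₁) * (c₀ * s₂) * K * L
      ≈⟨ ×.solve 5 (λ c₀ s₁ s₂ K L → (((c₀ ×.⊕ s₁) ×.⊕ (c₀ ×.⊕ s₂)) ×.⊕ K) ×.⊕ L
                                       ×.⊜ ((c₀ ×.⊕ c₀) ×.⊕ K) ×.⊕ ((s₁ ×.⊕ s₂) ×.⊕ L)) refl c₀ s₁ s₂ K L ⟩
    scale * (s₁ * s₂ * L)
      ≈⟨ *-congˡ (Ldown-link (face X) w (k ∸ ℓ ∸ 1) (∧-conicalˡ _ _ η⊆σ∧τ) (∧-conicalʳ _ _ η⊆σ∧τ)) ⟩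
    scale * ∑ (λ ρ → when (η ⊆ᵇ ρ) (when (isFaceOfSize (face X) (∣ η ∣ ℕ.+ (k ∸ ℓ ∸ 1)) ρ) (Ldown-term w σ τ ρ))) A
      ≡⟨ ≡.cong (λ j → scale * ∑ (λ ρ → when (η ⊆ᵇ ρ) (when (isFaceOfSize (face X) j ρ) (Ldown-term w σ τ ρ))) A)
                ∣η∣+[k∸ℓ∸1]≡k ⟩
    scale * ∑ (λ ρ → when (η ⊆ᵇ ρ) (when (isFacet ρ) (Ldown-term w σ τ ρ))) A
      ≈⟨ ∑-*ˡ scale _ A ⟩
    ∑ (λ ρ → scale * when (η ⊆ᵇ ρ) (when (isFacet ρ) (Ldown-term w σ τ ρ))) A
      ≈⟨ ∑-cong A (λ ρ → *-when (η ⊆ᵇ ρ) scale _) ⟩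
    ∑ (λ ρ → when (η ⊆ᵇ ρ) (scaledTerm ρ)) A ∎
    where
    s₁ = sign F (inversions σ η)
    s₂ = sign F (inversions τ η)
    K = fromℕ F (suc k)
    L = Leta F (face X) w ℓ k η σ τ
    ∣η∣+[k∸ℓ∸1]≡k : ∣ η ∣ ℕ.+ (k ∸ ℓ ∸ 1) ≡ k
    ∣η∣+[k∸ℓ∸1]≡k = ≡.trans (≡.cong (ℕ._+ (k ∸ ℓ ∸ 1)) (≡ᵇ-true⇒≡ ∣ η ∣ (suc ℓ) (∧-conicalʳ (face X η) _ η∈X)))
                            ([ℓ+1]+[k∸ℓ∸1]≡k ℓ<k)

  lhs≈∑-when-∑-when : sumL F summand (filterᵇ ⊆σ∧⊆τ (facesOfSize (face X) (suc ℓ)))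
                 ≈ ∑ (λ η → when (isCommonℓFace η) (∑ (λ ρ → when (η ⊆ᵇ ρ) (scaledTerm ρ)) A)) A
  lhs≈∑-when-∑-when = begin
    ∑ summand (filterᵇ ⊆σ∧⊆τ (filterᵇ isℓFace A))
      ≈⟨ ∑-filterᵇ ⊆σ∧⊆τ summand (filterᵇ isℓFace A) ⟩
    ∑ (λ η → when (⊆σ∧⊆τ η) (summand η)) (filterᵇ isℓFace A)
      ≈⟨ ∑-filterᵇ isℓFace _ A ⟩
    ∑ (λ η → when (isℓFace η) (when (⊆σ∧⊆τ η) (summand η))) A
      ≈⟨ ∑-cong A (λ η → when-cong (isℓFace η) (λ η∈X → when-cong (⊆σ∧⊆τ η) (summand≈∑ η∈X))) ⟩
    ∑ (λ η → when (isℓFace η) (when (⊆σ∧⊆τ η) (∑ (λ ρ → when (η ⊆ᵇ ρ) (scaledTerm ρ)) A))) A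
      ≈⟨ ∑-cong A (λ η → reflexive (when-∧ (isℓFace η) (⊆σ∧⊆τ η) _)) ⟨
    ∑ (λ η → when (isCommonℓFace η) (∑ (λ ρ → when (η ⊆ᵇ ρ) (scaledTerm ρ)) A)) A ∎

  common-ℓfaces-of : ∀ {ρ} → face X ρ ≡ true → ρ ⊆ᵇ σ ≡ true → ρ ⊆ᵇ τ ≡ true →
                     ∀ η → (isCommonℓFace η ∧ (η ⊆ᵇ ρ)) ≡ (η ⊆ᵇ ρ ∧ (∣ η ∣ ≡ᵇ suc ℓ))
  common-ℓfaces-of {ρ} ρ∈X ρ⊆σ ρ⊆τ η with η ⊆ᵇ ρ in η⊆ρ
  ... | false = ∧-zeroʳ (isCommonℓFace η)
  ... | true  = ≡.trans (∧-identityʳ (isCommonℓFace η))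
                  (≡.trans (≡.cong₂ (λ a b → (a ∧ (∣ η ∣ ≡ᵇ suc ℓ)) ∧ b)
                                    (down-closed X (⊆ᵇ⇒⊆ η⊆ρ) ρ∈X)
                                    (≡.cong₂ _∧_ (⊆ᵇ-trans η ρ σ η⊆ρ ρ⊆σ) (⊆ᵇ-trans η ρ τ η⊆ρ ρ⊆τ)))
                           (∧-identityʳ (∣ η ∣ ≡ᵇ suc ℓ)))

  ℓFaceCount : Subset n → Carrier
  ℓFaceCount ρ = ∑ (λ η → when (isCommonℓFace η ∧ (η ⊆ᵇ ρ)) 1#) A

  x*[y*0]≈z*0 : ∀ {x y z t} → t ≈ 0# → x * (y * t) ≈ z * t
  x*[y*0]≈z*0 {x} {y} {z} t≈0 = begin
    x * (y * _) ≈⟨ *-congˡ (trans (*-congˡ t≈0) (zeroʳ y)) ⟩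
    x * 0#      ≈⟨ zeroʳ x ⟩
    0#          ≈⟨ zeroʳ z ⟨
    z * 0#      ≈⟨ *-congˡ t≈0 ⟨
    z * _       ∎

  ℓFaceCount*scaledTerm≈when-facet : ∀ ρ → ℓFaceCount ρ * scaledTerm ρ
                                     ≈ when (isFacet ρ) (fromℕ F (k ∸ ℓ) * Ldown-term w σ τ ρ)
  ℓFaceCount*scaledTerm≈when-facet ρ with isFacet ρ in ρ∈X
  ... | false = trans (*-congˡ (zeroʳ scale)) (zeroʳ (ℓFaceCount ρ))
  ... | true with ρ ⊆ᵇ σ in ρ⊆σ | ρ ⊆ᵇ τ in ρ⊆τ
  ...   | false | _     = x*[y*0]≈z*0 (Ldown-term-vanishesˡ w ρ⊆σ)
  ...   | true  | false = x*[y*0]≈z*0 (Ldown-term-vanishesʳ w ρ⊆τ)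
  ...   | true  | true  = begin
    ℓFaceCount ρ * (scale * Ldown-term w σ τ ρ)
      ≈⟨ *-congʳ (∑-cong A (λ η → reflexive (≡.cong (λ b → when b 1#)
                    (common-ℓfaces-of (∧-conicalˡ (face X ρ) _ ρ∈X) ρ⊆σ ρ⊆τ η)))) ⟩
    ∑ (λ η → when (η ⊆ᵇ ρ ∧ (∣ η ∣ ≡ᵇ suc ℓ)) 1#) A * (scale * Ldown-term w σ τ ρ)
      ≈⟨ *-congʳ (∑-subsets-of-size ρ (suc ℓ)) ⟩
    fromℕ F (∣ ρ ∣ C suc ℓ) * (scale * Ldown-term w σ τ ρ)
      ≡⟨ ≡.cong (λ m → fromℕ F (m C suc ℓ) * (scale * Ldown-term w σ τ ρ))
                (≡ᵇ-true⇒≡ ∣ ρ ∣ k (∧-conicalʳ (face X ρ) _ ρ∈X)) ⟩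
    fromℕ F (k C suc ℓ) * (scale * Ldown-term w σ τ ρ)
      ≈⟨ *-assoc _ _ _ ⟨
    fromℕ F (k C suc ℓ) * scale * Ldown-term w σ τ ρ
      ≈⟨ *-congʳ [kCℓ+1]*scale≈k∸ℓ ⟩
    fromℕ F (k ∸ ℓ) * Ldown-term w σ τ ρ ∎

  ∑-ℓFaceCount*scaledTerm≈[k∸ℓ]*Ldown : ∑ (λ ρ → ℓFaceCount ρ * scaledTerm ρ) A
                                        ≈ fromℕ F (k ∸ ℓ) * Ldown F (face X) w k σ τ
  ∑-ℓFaceCount*scaledTerm≈[k∸ℓ]*Ldown = begin
    ∑ (λ ρ → ℓFaceCount ρ * scaledTerm ρ) A
      ≈⟨ ∑-cong A ℓFaceCount*scaledTerm≈when-facet ⟩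
    ∑ (λ ρ → when (isFacet ρ) (fromℕ F (k ∸ ℓ) * Ldown-term w σ τ ρ)) A
      ≈⟨ ∑-cong A (λ ρ → *-when (isFacet ρ) _ _) ⟨
    ∑ (λ ρ → fromℕ F (k ∸ ℓ) * when (isFacet ρ) (Ldown-term w σ τ ρ)) A
      ≈⟨ ∑-*ˡ (fromℕ F (k ∸ ℓ)) _ A ⟨
    fromℕ F (k ∸ ℓ) * ∑ (λ ρ → when (isFacet ρ) (Ldown-term w σ τ ρ)) A
      ≈⟨ *-congˡ (Ldown≈∑ (face X) w k σ τ) ⟨
    fromℕ F (k ∸ ℓ) * Ldown F (face X) w k σ τ ∎

proposition4p4 : ∀ {c ℓ₀} (F : SqrtField c ℓ₀) → let open SqrtField F in
  ∀ {n} (X : SimplicialComplex n) (w : Subset n → Carrier) →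
  (∀ σ → face X σ ≡ true → Pos (w σ)) →
  (ℓ k : ℕ) → ℓ < k → Σ (Subset n) (λ ρ → face X ρ ≡ true × suc k ≤ ∣ ρ ∣) →
  (σ τ : Subset n) →
  face X σ ≡ true → ∣ σ ∣ ≡ suc k → face X τ ≡ true → ∣ τ ∣ ≡ suc k →
  sumL F (λ η → sη F ℓ k η σ * sη F ℓ k η τ * fromℕ F (suc k) * Leta F (face X) w ℓ k η σ τ)
    (filterᵇ (λ η → (η ⊆ᵇ σ) ∧ (η ⊆ᵇ τ)) (facesOfSize (face X) (suc ℓ)))
  ≈ fromℕ F (k ∸ ℓ) * Ldown F (face X) w k σ τ
proposition4p4 F X w _ ℓ k ℓ<k _ σ τ _ _ _ _ = begin
  sumL F summand (filterᵇ ⊆σ∧⊆τ (facesOfSize (face X) (suc ℓ)))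
    ≈⟨ lhs≈∑-when-∑-when ⟩
  ∑ (λ η → when (isCommonℓFace η) (∑ (λ ρ → when (η ⊆ᵇ ρ) (scaledTerm ρ)) A)) A
    ≈⟨ double-counting isCommonℓFace _⊆ᵇ_ scaledTerm A A ⟩
  ∑ (λ ρ → ℓFaceCount ρ * scaledTerm ρ) A
    ≈⟨ ∑-ℓFaceCount*scaledTerm≈[k∸ℓ]*Ldown ⟩
  fromℕ F (k ∸ ℓ) * Ldown F (face X) w k σ τ ∎
  where
  open SqrtField F
  open Laplacian F
  open LinkSum F X w ℓ<k σ τ
  open SetoidReasoning setoid
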